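{- Let $n>3$ and $k$ be integers with $n+1\leq k<\frac{n(n-1)}{2}$, and let $i_0=i_0(n,k)$ be the greatest integer such that $k-1\geq n+(n-1)+\cdots+(n-i_0)$. Then $$\frac{\Gamma(n+1)}{\Gamma(n-i_0)}\leq m(n,k)\leq \frac{\Gamma(n+1)}{\Gamma(n-i_0)}\,e^n.$$
   Context: $\Gamma$ is Euler's Gamma function. $m(n,k)$ is the minimum of $\prod_{v\in V}v$ over all subsets $V\subseteq\{1,\dots,n\}$ with $1\in V$ and $\sum_{v\in V}v=k$. -}

module Defs where

open import Data.Bool using (Bool; true; false)
open import Data.Nat using (ℕ; zero; suc; _+_; _*_; _∸_; _^_; _!; _≟_)
open import Data.Nat.Properties using (_!≢0)
open import Data.Integer using (+_)
open import Data.Rational using (ℚ; _/_; 0ℚ) renaming (_+_ to _+ℚ_)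
open import Data.List using (List; []; _∷_; map; filter; _++_)
open import Data.Nat.ListAction using (sum; product)
open import Data.List.Relation.Unary.Any using (any?)
open import Data.List.Membership.Propositional using (_∈_)
open import Data.Vec using (Vec; []; _∷_)
open import Relation.Nullary.Decidable using (_×-dec_)

-- Euler's Gamma function at positive integers: Γ(x) = (x-1)!  (only used for x ≥ 1)
Γ : ℕ → ℕ
Γ x = (x ∸ 1) !

Γ-ratio : ℕ → ℕ → ℚ
Γ-ratio a b = (+ Γ a) / Γ b
  where instance _ = (b ∸ 1) !≢0

-- all subsets of {1,…,n}, encoded as characteristic vectors
allVecs : (n : ℕ) → List (Vec Bool n)
allVecs zero    = [] ∷ []
allVecs (suc n) = map (true ∷_) (allVecs n) ++ map (false ∷_) (allVecs n)

-- elements of the subset: position i (0-based) stands for the number o + i + 1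
elemsFrom : ∀ {n} → ℕ → Vec Bool n → List ℕ
elemsFrom o []          = []
elemsFrom o (true ∷ v)  = suc o ∷ elemsFrom (suc o) v
elemsFrom o (false ∷ v) = elemsFrom (suc o) v

toSet : ∀ {n} → Vec Bool n → List ℕ
toSet = elemsFrom 0

feasible : ℕ → ℕ → List (List ℕ)
feasible n k =
  filter (λ V → any? (1 ≟_) V ×-dec (sum V ≟ k)) (map toSet (allVecs n))

minimumℕ : List ℕ → ℕ
minimumℕ []       = 0   -- never used under the hypotheses (feasible set nonempty)
minimumℕ (x ∷ []) = x
minimumℕ (x ∷ y ∷ xs) = Data.Nat._⊓_ x (minimumℕ (y ∷ xs))

-- m(n,k) = min { ∏_{v∈V} v : V ⊆ {1,…,n}, 1 ∈ V, ∑_{v∈V} v = k }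
m : ℕ → ℕ → ℕ
m n k = minimumℕ (map product (feasible n k))

sumDown : ℕ → ℕ → ℕ
sumDown n zero    = n
sumDown n (suc i) = sumDown n i + (n ∸ suc i)

expPartial : ℕ → ℕ → ℚ
expPartial x zero    = (+ 1) / 1
expPartial x (suc N) = expPartial x N +ℚ term
  where instance _ = suc N !≢0
        term = (+ (x ^ suc N)) / (suc N !)

module Submission where

-- Let M = n - i₀ ≥ 4 and T = {M, …, n}, so that ∑ T = n + ⋯ + (n - i₀) ≤ k - 1 and ∏ T = n! / (M - 1)!.
-- Lower bound: write a feasible V as {1} ∪ W with W ⊆ {2, …, n}. As x ↦ x^(1/x) decreases from 3 on and
-- 2^(1/2) ≥ M^(1/M), we have x^M ≤ M^x for x ≥ M and x^M ≥ M^x for 2 ≤ x ≤ M, so T minimises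
-- ∏_{x ∈ W} x^M / M^x; with ∑ T ≤ ∑ W this gives (∏ T)^M ≤ (∏ W)^M.
-- Upper bound: by maximality of i₀, k - 1 = ∑ T + d with d < M - 1, and one of {1} ∪ T, {1, d} ∪ T,
-- {1, 2, M - 1} ∪ T ∖ {M} is feasible with product at most (n + 1) ∏ T ≤ e^n ∏ T.

open import Data.Bool using (Bool; true; false; if_then_else_; _∨_)
open import Data.Integer as ℤ using (+_; +≤+)
import Data.Integer.Properties as ℤ
open import Data.List using (List; []; _∷_; map; _++_)
open import Data.List.Membership.Propositional using (_∈_)
open import Data.List.Membership.Propositional.Properties
  using (∈-map⁺; ∈-map⁻; ∈-++⁺ˡ; ∈-++⁺ʳ; ∈-filter⁺; ∈-filter⁻)
open import Data.List.Relation.Binary.Permutation.Propositional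
  using (_↭_; ↭-prep; ↭-swap; ↭-trans; ↭-refl; ↭-reflexive; ↭-sym)
open import Data.List.Relation.Binary.Permutation.Propositional.Properties using (∈-resp-↭)
open import Data.List.Relation.Unary.Any using (here; there; any?)
open import Data.Nat
open import Data.Nat.ListAction using (sum; product)
open import Data.Nat.ListAction.Properties using (sum-↭; product-↭)
open import Data.Nat.Properties
open import Data.Nat.Tactic.RingSolver using (solve-∀)
open import Data.Product using (_×_; _,_; ∃-syntax; Σ-syntax; proj₁; proj₂)
open import Data.Rational using (toℚᵘ) renaming (_≤_ to _≤ℚ_; _*_ to _*ℚ_; _/_ to _/ℚ_)
open import Data.Rational.Properties using (toℚᵘ-fromℚᵘ; toℚᵘ-cancel-≤; toℚᵘ-homo-+; toℚᵘ-homo-*)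
open import Data.Rational.Unnormalised as ℚᵘ using (mkℚᵘ; *≤*; _≃_) renaming (_/_ to _/ᵘ_; _*_ to _*ᵘ_)
import Data.Rational.Unnormalised.Properties as ℚᵘ
open import Data.Vec using (Vec; []; _∷_)
open import Function using (_∘_)
open import Relation.Binary.Definitions using (tri<; tri≈; tri>)
open import Relation.Binary.PropositionalEquality
open import Relation.Nullary using (yes; no; contradiction)
open import Relation.Nullary.Decidable using (dec-true; dec-false; _×-dec_)

open import Algebra.Properties.CommutativeSemigroup *-commutativeSemigroup using (interchange)
open import Defs

-- Powers and x^(1/x)

^-distribʳ-* : ∀ a b e → (a * b) ^ e ≡ a ^ e * b ^ e
^-distribʳ-* a b zero    = refl
^-distribʳ-* a b (suc e) = begin
  a * b * (a * b) ^ e      ≡⟨ cong (a * b *_) (^-distribʳ-* a b e) ⟩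
  a * b * (a ^ e * b ^ e)  ≡⟨ interchange a b (a ^ e) (b ^ e) ⟩
  a * a ^ e * (b * b ^ e)  ∎
  where open ≡-Reasoning

^-swap : ∀ x m n → (x ^ m) ^ n ≡ (x ^ n) ^ m
^-swap x m n = begin
  (x ^ m) ^ n  ≡⟨ ^-*-assoc x m n ⟩
  x ^ (m * n)  ≡⟨ cong (x ^_) (*-comm m n) ⟩
  x ^ (n * m)  ≡⟨ ^-*-assoc x n m ⟨
  (x ^ n) ^ m  ∎
  where open ≡-Reasoning

^-cancelʳ-≤ : ∀ e .{{_ : NonZero e}} {a b} → a ^ e ≤ b ^ e → a ≤ b
^-cancelʳ-≤ e aᵉ≤bᵉ = ≮⇒≥ (λ b<a → <⇒≱ (^-monoˡ-< e b<a) aᵉ≤bᵉ)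

-- a ≥ᵣ b  means  a^(1/a) ≥ b^(1/b)
_≥ᵣ_ : ℕ → ℕ → Set
a ≥ᵣ b = b ^ a ≤ a ^ b

≥ᵣ-trans : ∀ {a b c} → 1 ≤ b → a ≥ᵣ b → b ≥ᵣ c → a ≥ᵣ c
≥ᵣ-trans {a} {b} {c} 1≤b a≥b b≥c = ^-cancelʳ-≤ b {{>-nonZero 1≤b}} (begin
  (c ^ a) ^ b  ≡⟨ ^-swap c a b ⟩
  (c ^ b) ^ a  ≤⟨ ^-monoˡ-≤ a b≥c ⟩
  (b ^ c) ^ a  ≡⟨ ^-swap b c a ⟩
  (b ^ a) ^ c  ≤⟨ ^-monoˡ-≤ c a≥b ⟩
  (a ^ b) ^ c  ≡⟨ ^-swap a b c ⟩
  (a ^ c) ^ b  ∎)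
  where open ≤-Reasoning

-- (1 + 1/n)^t ≤ 1 + t/n + (t/n)², cleared of denominators
suc-^-bound : ∀ n t → t ≤ n → suc n ^ t * (n * n) ≤ n ^ t * (n * n + t * n + t * t)
suc-^-bound n zero    _   = ≤-reflexive (base n)
  where
  base : ∀ n → 1 * (n * n) ≡ 1 * (n * n + 0 * n + 0 * 0)
  base = solve-∀
suc-^-bound n (suc t) t<n = begin
  suc n * suc n ^ t * (n * n)      ≡⟨ *-assoc (suc n) (suc n ^ t) (n * n) ⟩
  suc n * (suc n ^ t * (n * n))    ≤⟨ *-monoʳ-≤ (suc n) (suc-^-bound n t (<⇒≤ t<n)) ⟩
  suc n * (n ^ t * E t)            ≡⟨ x*[y*z]≡y*[x*z] (suc n) (n ^ t) (E t) ⟩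
  n ^ t * (suc n * E t)            ≤⟨ *-monoʳ-≤ (n ^ t) step ⟩
  n ^ t * (n * E (suc t))          ≡⟨ x*[y*z]≡y*[x*z] (n ^ t) n (E (suc t)) ⟩
  n * (n ^ t * E (suc t))          ≡⟨ *-assoc n (n ^ t) (E (suc t)) ⟨
  n * n ^ t * E (suc t)            ∎
  where
  open ≤-Reasoning
  E : ℕ → ℕ
  E s = n * n + s * n + s * s
  x*[y*z]≡y*[x*z] : ∀ x y z → x * (y * z) ≡ y * (x * z)
  x*[y*z]≡y*[x*z] = solve-∀
  identity : ∀ n t → suc n * (n * n + t * n + t * t) + (t * n + n)
                   ≡ n * (n * n + suc t * n + suc t * suc t) + t * t
  identity = solve-∀
  t*t≤t*n+n : t * t ≤ t * n + n
  t*t≤t*n+n = ≤-trans (*-monoʳ-≤ t (<⇒≤ t<n)) (m≤m+n (t * n) n)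
  step : suc n * E t ≤ n * E (suc t)
  step = +-cancelʳ-≤ (t * t) _ _ (begin
    suc n * E t + t * t          ≤⟨ +-monoʳ-≤ (suc n * E t) t*t≤t*n+n ⟩
    suc n * E t + (t * n + n)    ≡⟨ identity n t ⟩
    n * E (suc t) + t * t        ∎)

≥ᵣ-suc : ∀ {n} → 3 ≤ n → n ≥ᵣ suc n
≥ᵣ-suc {n@(suc _)} 3≤n = *-cancelʳ-≤ (suc n ^ n) (n ^ suc n) (n * n) (begin
  suc n ^ n * (n * n)              ≤⟨ suc-^-bound n n ≤-refl ⟩
  n ^ n * (n * n + n * n + n * n)  ≡⟨ thrice (n ^ n) (n * n) ⟩
  n ^ n * 3 * (n * n)              ≤⟨ *-monoˡ-≤ (n * n) (*-monoʳ-≤ (n ^ n) 3≤n) ⟩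
  n ^ n * n * (n * n)              ≡⟨ cong (_* (n * n)) (*-comm (n ^ n) n) ⟩
  n ^ suc n * (n * n)              ∎)
  where
  open ≤-Reasoning
  thrice : ∀ x y → x * (y + y + y) ≡ x * 3 * y
  thrice = solve-∀

≥ᵣ-antitone : ∀ {a b} → 3 ≤ a → a ≤ b → a ≥ᵣ b
≥ᵣ-antitone {b = zero}  (s≤s _) ()
≥ᵣ-antitone {a} {suc b} 3≤a a≤1+b with a ≤? b
... | yes a≤b = ≥ᵣ-trans (≤-trans (s≤s z≤n) (≤-trans 3≤a a≤b))
                  (≥ᵣ-antitone 3≤a a≤b) (≥ᵣ-suc (≤-trans 3≤a a≤b))
... | no  a≰b rewrite ≤-antisym a≤1+b (≰⇒> a≰b) = ≤-refl

≥ᵣ-from-2 : ∀ {x M} → 4 ≤ M → 2 ≤ x → x ≤ M → x ≥ᵣ M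
≥ᵣ-from-2 {1}                 _   (s≤s ()) _
≥ᵣ-from-2 {2}             {M} 4≤M _        _   =
  ≥ᵣ-trans {2} {4} {M} (s≤s z≤n) ≤-refl (≥ᵣ-antitone (s≤s (s≤s (s≤s z≤n))) 4≤M)
≥ᵣ-from-2 {suc (suc (suc _))} _   _        x≤M = ≥ᵣ-antitone (s≤s (s≤s (s≤s z≤n))) x≤M

-- Subsets of an interval

charVec : (ℕ → Bool) → (o l : ℕ) → Vec Bool l
charVec P o zero    = []
charVec P o (suc l) = P (suc o) ∷ charVec P (suc o) l

-- the x ∈ (o, o + l] with P x, in increasing order
members : (ℕ → Bool) → (o l : ℕ) → List ℕ
members P o l = elemsFrom o (charVec P o l)

insert : ℕ → (ℕ → Bool) → ℕ → Bool
insert a P x = (x ≡ᵇ a) ∨ P x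

atLeast : ℕ → ℕ → Bool
atLeast M x = M ≤ᵇ x

atLeast-true : ∀ {M x} → M ≤ x → atLeast M x ≡ true
atLeast-true {M} {x} = dec-true (M ≤? x)

atLeast-false : ∀ {M x} → x < M → atLeast M x ≡ false
atLeast-false {M} {x} x<M = dec-false (M ≤? x) (<⇒≱ x<M)

insert-at : ∀ {P} a → insert a P a ≡ true
insert-at a rewrite dec-true (a ≟ a) refl = refl

insert-not-at : ∀ {P a x} → x ≢ a → insert a P x ≡ P x
insert-not-at {P} {a} {x} x≢a rewrite dec-false (x ≟ a) x≢a = refl

insert-false : ∀ {P a x} → x ≢ a → P x ≡ false → insert a P x ≡ false
insert-false {P} x≢a Px = trans (insert-not-at {P} x≢a) Px

members-cong : ∀ {P Q} o l → (∀ x → o < x → P x ≡ Q x) → members P o l ≡ members Q o l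
members-cong {P} {Q} o l P≗Q = cong (elemsFrom o) (charVec-cong o l P≗Q)
  where
  charVec-cong : ∀ o l → (∀ x → o < x → P x ≡ Q x) → charVec P o l ≡ charVec Q o l
  charVec-cong o zero    _   = refl
  charVec-cong o (suc l) P≗Q =
    cong₂ _∷_ (P≗Q (suc o) ≤-refl) (charVec-cong (suc o) l (λ x o<x → P≗Q x (<⇒≤ o<x)))

members-none : ∀ {P} o l → (∀ x → o < x → x ≤ o + l → P x ≡ false) → members P o l ≡ []
members-none     o zero    _    = refl
members-none {P} o (suc l) none
  rewrite none (suc o) ≤-refl (subst (suc o ≤_) (sym (+-suc o l)) (s≤s (m≤m+n o l))) =
    members-none (suc o) l λ x o<x x≤ → none x (<⇒≤ o<x) (subst (x ≤_) (sym (+-suc o l)) x≤)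

members-skip : ∀ {P} o l → P (suc o) ≡ false → members P o (suc l) ≡ members P (suc o) l
members-skip o l P[1+o] rewrite P[1+o] = refl

members-insert : ∀ {P a} o l → P a ≡ false → o < a → a ≤ o + l →
                 members (insert a P) o l ↭ a ∷ members P o l
members-insert     o zero    _  o<a a≤o+0 =
  contradiction (subst (o <_) (+-identityʳ o) (≤-trans o<a a≤o+0)) (n≮n o)
members-insert {P} {a} o (suc l) Pa o<a a≤o+l with suc o ≟ a
... | yes refl rewrite insert-at {P} (suc o) | Pa =
  ↭-reflexive (cong (suc o ∷_) (members-cong (suc o) l λ x o<x → insert-not-at {P} (>⇒≢ o<x)))
... | no 1+o≢a rewrite insert-not-at {P} 1+o≢a
  with P (suc o) | members-insert (suc o) l Pa (≤∧≢⇒< o<a 1+o≢a) (subst (a ≤_) (+-suc o l) a≤o+l)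
...   | true  | ih = ↭-trans (↭-prep (suc o) ih) (↭-swap (suc o) a ↭-refl)
...   | false | ih = ih

sum-members-insert : ∀ {P a o l} → P a ≡ false → o < a → a ≤ o + l →
                     sum (members (insert a P) o l) ≡ a + sum (members P o l)
sum-members-insert Pa o<a a≤o+l = sum-↭ (members-insert _ _ Pa o<a a≤o+l)

product-members-insert : ∀ {P a o l} → P a ≡ false → o < a → a ≤ o + l →
                         product (members (insert a P) o l) ≡ a * product (members P o l)
product-members-insert Pa o<a a≤o+l = product-↭ (members-insert _ _ Pa o<a a≤o+l)

atLeast-insert : ∀ M x → atLeast M x ≡ insert M (atLeast (suc M)) x
atLeast-insert M x with <-cmp x M
... | tri< x<M _ _ rewrite atLeast-false x<M | insert-not-at {atLeast (suc M)} (<⇒≢ x<M)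
                         | atLeast-false {suc M} (m<n⇒m<1+n x<M) = refl
... | tri≈ _ refl _ rewrite atLeast-true (≤-refl {x}) | insert-at {atLeast (suc x)} x = refl
... | tri> _ _ M<x rewrite atLeast-true (<⇒≤ M<x) | insert-not-at {atLeast (suc M)} (>⇒≢ M<x)
                         | atLeast-true M<x = refl

members-atLeast-↭ : ∀ {M} o l → o < M → M ≤ o + l →
                    members (atLeast M) o l ↭ M ∷ members (atLeast (suc M)) o l
members-atLeast-↭ {M} o l o<M M≤o+l =
  subst (_↭ M ∷ members (atLeast (suc M)) o l) (members-cong o l (λ x _ → sym (atLeast-insert M x)))
        (members-insert o l (atLeast-false (n<1+n M)) o<M M≤o+l)

members-atLeast-none : ∀ o l → members (atLeast (suc (o + l))) o l ≡ []
members-atLeast-none o l = members-none o l (λ x _ x≤o+l → atLeast-false (s≤s x≤o+l))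

∸-suc : ∀ {n i} → i < n → n ∸ i ≡ suc (n ∸ suc i)
∸-suc {suc n} {zero}  _         = refl
∸-suc {suc n} {suc i} (s≤s i<n) = ∸-suc i<n

sum-atLeast : ∀ {n i} → i < n → sum (members (atLeast (n ∸ i)) 0 n) ≡ sumDown n i
sum-atLeast {n} {zero} 0<n = begin
  sum (members (atLeast n) 0 n)            ≡⟨ sum-↭ (members-atLeast-↭ 0 n 0<n ≤-refl) ⟩
  n + sum (members (atLeast (suc n)) 0 n)  ≡⟨ cong (λ xs → n + sum xs) (members-atLeast-none 0 n) ⟩
  n + 0                                    ≡⟨ +-identityʳ n ⟩
  n                                        ∎
  where open ≡-Reasoning
sum-atLeast {n} {suc i} 1+i<n = begin
  sum (members (atLeast j) 0 n)            ≡⟨ sum-↭ (members-atLeast-↭ 0 n (m<n⇒0<n∸m 1+i<n) (m∸n≤m n (suc i))) ⟩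
  j + sum (members (atLeast (suc j)) 0 n)  ≡⟨ cong (λ M → j + sum (members (atLeast M) 0 n)) (∸-suc i<n) ⟨
  j + sum (members (atLeast (n ∸ i)) 0 n)  ≡⟨ cong (_+_ j) (sum-atLeast i<n) ⟩
  j + sumDown n i                          ≡⟨ +-comm j (sumDown n i) ⟩
  sumDown n i + j                          ∎
  where
  open ≡-Reasoning
  j = n ∸ suc i
  i<n = <-trans (n<1+n i) 1+i<n

product-atLeast : ∀ {n j} → j ≤ n → product (members (atLeast (suc j)) 0 n) * j ! ≡ n !
product-atLeast {n} {j} j≤n = subst (λ n → product (members (atLeast (suc j)) 0 n) * j ! ≡ n !)
                                    (m+[n∸m]≡n j≤n) (above j (n ∸ j))
  where
  above : ∀ j e → product (members (atLeast (suc j)) 0 (j + e)) * j ! ≡ (j + e) !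
  above j zero rewrite +-identityʳ j | members-atLeast-none 0 j = *-identityˡ (j !)
  above j (suc e) rewrite +-suc j e = begin
    product (members (atLeast (suc j)) 0 (suc j + e)) * j !
      ≡⟨ cong (_* j !) (product-↭ (members-atLeast-↭ 0 (suc j + e) (s≤s z≤n) (s≤s (m≤m+n j e)))) ⟩
    suc j * product (members (atLeast (2 + j)) 0 (suc j + e)) * j !
      ≡⟨ x*y*z≡y*[x*z] (suc j) (product (members (atLeast (2 + j)) 0 (suc j + e))) (j !) ⟩
    product (members (atLeast (2 + j)) 0 (suc j + e)) * (suc j) !
      ≡⟨ above (suc j) e ⟩
    (suc j + e) !  ∎
    where
    open ≡-Reasoning
    x*y*z≡y*[x*z] : ∀ x y z → x * y * z ≡ y * (x * z)
    x*y*z≡y*[x*z] = solve-∀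

sumDown-mono : ∀ n {i j} → i ≤ j → sumDown n i ≤ sumDown n j
sumDown-mono n {j = zero}  z≤n = ≤-refl
sumDown-mono n {i} {suc j} i≤1+j with i ≤? j
... | yes i≤j = ≤-trans (sumDown-mono n i≤j) (m≤m+n (sumDown n j) (n ∸ suc j))
... | no  i≰j rewrite ≤-antisym i≤1+j (≰⇒> i≰j) = ≤-refl

-- 2 (n + ⋯ + (n - i)) is the difference of the triangular numbers n (n + 1) and (n - i) (n - i - 1)
sumDown-*2 : ∀ {n i} → i < n → sumDown n i * 2 + (n ∸ i) * (n ∸ suc i) ≡ n * suc n
sumDown-*2 {suc n} {zero}  _ = base n
  where
  base : ∀ n → suc n * 2 + suc n * n ≡ suc n * suc (suc n)
  base = solve-∀
sumDown-*2 {n} {suc i} 1+i<n = begin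
  (s + (n ∸ suc i)) * 2 + (n ∸ suc i) * c′  ≡⟨ cong (λ c → (s + c) * 2 + c * c′) (∸-suc 1+i<n) ⟩
  (s + suc c′) * 2 + suc c′ * c′            ≡⟨ step s c′ ⟩
  s * 2 + suc (suc c′) * suc c′             ≡⟨ cong (λ c → s * 2 + suc c * c) (∸-suc 1+i<n) ⟨
  s * 2 + suc (n ∸ suc i) * (n ∸ suc i)     ≡⟨ cong (λ c → s * 2 + c * (n ∸ suc i)) (∸-suc i<n) ⟨
  s * 2 + (n ∸ i) * (n ∸ suc i)             ≡⟨ sumDown-*2 i<n ⟩
  n * suc n                                 ∎
  where
  open ≡-Reasoning
  s = sumDown n i
  c′ = n ∸ suc (suc i)
  i<n = <-trans (n<1+n i) 1+i<n
  step : ∀ s c → (s + suc c) * 2 + suc c * c ≡ s * 2 + suc (suc c) * suc c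
  step = solve-∀

sumDown-fits⇒4≤n∸i : ∀ {n k i} → 3 < n → k * 2 < n * (n ∸ 1) → sumDown n i ≤ k ∸ 1 → 4 ≤ n ∸ i
sumDown-fits⇒4≤n∸i {n@(suc n′)} {k} {i} 3<n k*2<n*n′ fits with 4 ≤? n ∸ i
... | yes 4≤n∸i = 4≤n∸i
... | no  4≰n∸i = contradiction k*2<n*n′ (≤⇒≯ (≤-trans (m≤m+n (n * n′) 2) (+-cancelʳ-≤ 6 _ _ (begin
  n * n′ + 2 + 6                  ≡⟨ +-assoc (n * n′) 2 6 ⟩
  n * n′ + 4 * 2                  ≤⟨ +-monoʳ-≤ (n * n′) (*-monoˡ-≤ 2 3<n) ⟩
  n * n′ + n * 2                  ≡⟨ *-distribˡ-+ n n′ 2 ⟨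
  n * (n′ + 2)                    ≡⟨ cong (n *_) (+-comm n′ 2) ⟩
  n * suc n                       ≡⟨ sumDown-*2 n∸3<n ⟨
  sumDown n (n ∸ 3) * 2 + (n ∸ (n ∸ 3)) * (n ∸ suc (n ∸ 3))
                                  ≡⟨ cong (_+_ (sumDown n (n ∸ 3) * 2)) (cong₂ _*_ n∸[n∸3]≡3 n∸[1+n∸3]≡2) ⟩
  sumDown n (n ∸ 3) * 2 + 6       ≤⟨ +-monoˡ-≤ 6 (*-monoˡ-≤ 2 (≤-trans (sumDown-mono n n∸3≤i) fits)) ⟩
  (k ∸ 1) * 2 + 6                 ≤⟨ +-monoˡ-≤ 6 (*-monoˡ-≤ 2 (m∸n≤m k 1)) ⟩
  k * 2 + 6                       ∎))))
  where
  open ≤-Reasoning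
  3≤n = <⇒≤ 3<n
  n∸3<n : n ∸ 3 < n
  n∸3<n = s≤s (m∸n≤m n′ 2)
  n∸3≤i : n ∸ 3 ≤ i
  n∸3≤i = m≤n+o⇒m∸n≤o n 3 (begin
    n            ≤⟨ m≤n+m∸n n i ⟩
    i + (n ∸ i)  ≤⟨ +-monoʳ-≤ i (≤-pred (≰⇒> 4≰n∸i)) ⟩
    i + 3        ≡⟨ +-comm i 3 ⟩
    3 + i        ∎)
  n∸[n∸3]≡3 : n ∸ (n ∸ 3) ≡ 3
  n∸[n∸3]≡3 = m∸[m∸n]≡n 3≤n
  n∸[1+n∸3]≡2 : n ∸ suc (n ∸ 3) ≡ 2
  n∸[1+n∸3]≡2 = suc-injective (trans (sym (∸-suc n∸3<n)) n∸[n∸3]≡3)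

-- The exchange argument

-- product L ^ M / M ^ sum L is the product of x ^ M / M ^ x over x ∈ L
powProduct powSum : ℕ → List ℕ → ℕ
powProduct M L = product L ^ M
powSum     M L = M ^ sum L

powProduct-∷ : ∀ M o b {l} (v : Vec Bool l) →
  powProduct M (elemsFrom o (b ∷ v)) ≡ (if b then suc o ^ M else 1) * powProduct M (elemsFrom (suc o) v)
powProduct-∷ M o true  v = ^-distribʳ-* (suc o) _ M
powProduct-∷ M o false v = sym (*-identityˡ _)

powSum-∷ : ∀ M o b {l} (v : Vec Bool l) →
  powSum M (elemsFrom o (b ∷ v)) ≡ (if b then M ^ suc o else 1) * powSum M (elemsFrom (suc o) v)
powSum-∷ M o true  v = ^-distribˡ-+-* M (suc o) _
powSum-∷ M o false v = sym (*-identityˡ _)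

atLeast-factor-≤ : ∀ {M x} → 4 ≤ M → 2 ≤ x → ∀ b →
  (if atLeast M x then x ^ M else 1) * (if b then M ^ x else 1)
    ≤ (if b then x ^ M else 1) * (if atLeast M x then M ^ x else 1)
atLeast-factor-≤ {M} {x} 4≤M 2≤x b with M ≤? x
atLeast-factor-≤ 4≤M 2≤x true  | yes M≤x rewrite atLeast-true M≤x = ≤-refl
atLeast-factor-≤ 4≤M 2≤x false | yes M≤x rewrite atLeast-true M≤x =
  subst₂ _≤_ (sym (*-identityʳ _)) (sym (*-identityˡ _))
    (≥ᵣ-antitone (≤-trans (s≤s (s≤s (s≤s z≤n))) 4≤M) M≤x)
atLeast-factor-≤ 4≤M 2≤x true  | no M≰x rewrite atLeast-false (≰⇒> M≰x) =
  subst₂ _≤_ (sym (*-identityˡ _)) (sym (*-identityʳ _))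
    (≥ᵣ-from-2 4≤M 2≤x (<⇒≤ (≰⇒> M≰x)))
atLeast-factor-≤ 4≤M 2≤x false | no M≰x rewrite atLeast-false (≰⇒> M≰x) = ≤-refl

atLeast-exchange : ∀ {M} → 4 ≤ M → ∀ {o l} → 1 ≤ o → (v : Vec Bool l) →
  powProduct M (members (atLeast M) o l) * powSum M (elemsFrom o v)
    ≤ powProduct M (elemsFrom o v) * powSum M (members (atLeast M) o l)
atLeast-exchange 4≤M {l = zero}  1≤o [] = ≤-refl
atLeast-exchange {M} 4≤M {o} {suc l} 1≤o (b ∷ v) = begin
  powProduct M T * powSum M W
    ≡⟨ cong₂ _*_ (powProduct-∷ M o t T′) (powSum-∷ M o b v) ⟩
  (xᴹ t * powProduct M T″) * (Mˣ b * powSum M W′)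
    ≡⟨ interchange (xᴹ t) _ (Mˣ b) _ ⟩
  (xᴹ t * Mˣ b) * (powProduct M T″ * powSum M W′)
    ≤⟨ *-mono-≤ (atLeast-factor-≤ 4≤M (s≤s 1≤o) b)
                (atLeast-exchange 4≤M (≤-trans 1≤o (n≤1+n o)) v) ⟩
  (xᴹ b * Mˣ t) * (powProduct M W′ * powSum M T″)
    ≡⟨ interchange (xᴹ b) (Mˣ t) _ _ ⟩
  (xᴹ b * powProduct M W′) * (Mˣ t * powSum M T″)
    ≡⟨ cong₂ _*_ (powProduct-∷ M o b v) (powSum-∷ M o t T′) ⟨
  powProduct M W * powSum M T  ∎
  where
  open ≤-Reasoning
  xᴹ Mˣ : Bool → ℕ
  xᴹ c = if c then suc o ^ M else 1
  Mˣ c = if c then M ^ suc o else 1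
  t = atLeast M (suc o)
  T′ = charVec (atLeast M) (suc o) l
  T = members (atLeast M) o (suc l)
  T″ = elemsFrom (suc o) T′
  W = elemsFrom o (b ∷ v)
  W′ = elemsFrom (suc o) v

atLeast-minimises-product : ∀ {M o l} → 4 ≤ M → 1 ≤ o → (v : Vec Bool l) →
  sum (members (atLeast M) o l) ≤ sum (elemsFrom o v) →
  product (members (atLeast M) o l) ≤ product (elemsFrom o v)
atLeast-minimises-product {M} {o} {l} 4≤M 1≤o v sumT≤sumW =
  ^-cancelʳ-≤ M (*-cancelʳ-≤ _ _ (powSum M W) (begin
    powProduct M T * powSum M W  ≤⟨ atLeast-exchange 4≤M 1≤o v ⟩
    powProduct M W * powSum M T  ≤⟨ *-monoʳ-≤ (powProduct M W) (^-monoʳ-≤ M sumT≤sumW) ⟩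
    powProduct M W * powSum M W  ∎))
  where
  open ≤-Reasoning
  instance
    M≢0 : NonZero M
    M≢0 = >-nonZero (≤-trans (s≤s z≤n) 4≤M)
    powSum≢0 : NonZero (powSum M (elemsFrom o v))
    powSum≢0 = m^n≢0 M (sum (elemsFrom o v))
  T = members (atLeast M) o l
  W = elemsFrom o v

-- Feasible sets

allVecs-complete : ∀ {n} (v : Vec Bool n) → v ∈ allVecs n
allVecs-complete []                = here refl
allVecs-complete (true ∷ v)        = ∈-++⁺ˡ (∈-map⁺ (true ∷_) (allVecs-complete v))
allVecs-complete {suc n} (false ∷ v) =
  ∈-++⁺ʳ (map (true ∷_) (allVecs n)) (∈-map⁺ (false ∷_) (allVecs-complete v))

feasible⁺ : ∀ {n k} (v : Vec Bool n) → 1 ∈ toSet v → sum (toSet v) ≡ k → toSet v ∈ feasible n k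
feasible⁺ {n} {k} v 1∈v sum≡k =
  ∈-filter⁺ (λ V → any? (1 ≟_) V ×-dec (sum V ≟ k)) (∈-map⁺ toSet (allVecs-complete v)) (1∈v , sum≡k)

feasible⁻ : ∀ {n k V} → V ∈ feasible n k → ∃[ v ] V ≡ toSet v × 1 ∈ V × sum V ≡ k
feasible⁻ {n} {k} V∈
  with ∈-filter⁻ (λ V → any? (1 ≟_) V ×-dec (sum V ≟ k)) {xs = map toSet (allVecs n)} V∈
... | V∈sets , 1∈V , sum≡k with ∈-map⁻ toSet V∈sets
...   | v , _ , V≡v = v , V≡v , 1∈V , sum≡k

elemsFrom-> : ∀ {l y} o (v : Vec Bool l) → y ∈ elemsFrom o v → o < y
elemsFrom-> o (true  ∷ v) (here refl) = ≤-refl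
elemsFrom-> o (true  ∷ v) (there y∈)  = <⇒≤ (elemsFrom-> (suc o) v y∈)
elemsFrom-> o (false ∷ v) y∈          = <⇒≤ (elemsFrom-> (suc o) v y∈)

feasible-starts-with-1 : ∀ {n k V} → V ∈ feasible (suc n) k →
  Σ[ w ∈ Vec Bool n ] V ≡ 1 ∷ elemsFrom 1 w × suc (sum (elemsFrom 1 w)) ≡ k
feasible-starts-with-1 {n} V∈ with feasible⁻ {suc n} V∈
... | true  ∷ w , refl , _   , sum≡k = w , refl , sum≡k
... | false ∷ w , refl , 1∈V , _     = contradiction (elemsFrom-> 1 w 1∈V) (n≮n 1)

minimumℕ-≤ : ∀ {x} xs → x ∈ xs → minimumℕ xs ≤ x
minimumℕ-≤ (x ∷ [])     (here refl) = ≤-refl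
minimumℕ-≤ (x ∷ y ∷ xs) (here refl) = m⊓n≤m x _
minimumℕ-≤ (x ∷ y ∷ xs) (there x∈)  = ≤-trans (m⊓n≤n x _) (minimumℕ-≤ (y ∷ xs) x∈)

≤-minimumℕ : ∀ {b y} xs → (∀ {x} → x ∈ xs → b ≤ x) → y ∈ xs → b ≤ minimumℕ xs
≤-minimumℕ (x ∷ [])     b≤ _ = b≤ (here refl)
≤-minimumℕ (x ∷ y ∷ xs) b≤ _ = ⊓-glb (b≤ (here refl)) (≤-minimumℕ (y ∷ xs) (b≤ ∘ there) (here refl))

m≤product : ∀ {n k V} → V ∈ feasible n k → m n k ≤ product V
m≤product {n} {k} V∈ = minimumℕ-≤ (map product (feasible n k)) (∈-map⁺ product V∈)

≤m : ∀ {n k b V} → (∀ {W} → W ∈ feasible n k → b ≤ product W) → V ∈ feasible n k → b ≤ m n k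
≤m {n} {k} {b} b≤ V∈ = ≤-minimumℕ (map product (feasible n k)) b≤product (∈-map⁺ product V∈)
  where
  b≤product : ∀ {x} → x ∈ map product (feasible n k) → b ≤ x
  b≤product x∈ with ∈-map⁻ product x∈
  ... | W , W∈ , refl = b≤ W∈

product-atLeast≤m : ∀ {n k M V} → 4 ≤ M → sum (members (atLeast M) 0 (suc n)) ≤ k →
              V ∈ feasible (suc n) (suc k) → product (members (atLeast M) 0 (suc n)) ≤ m (suc n) (suc k)
product-atLeast≤m {n} {k} {M} 4≤M sumT≤k = ≤m {suc n} {suc k} T≤W
  where
  open ≤-Reasoning
  T T₁ : List ℕ
  T = members (atLeast M) 0 (suc n)
  T₁ = members (atLeast M) 1 n
  T≡T₁ : T ≡ T₁
  T≡T₁ = members-skip 0 n (atLeast-false (≤-trans (s≤s (s≤s z≤n)) 4≤M))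
  T≤W : ∀ {W} → W ∈ feasible (suc n) (suc k) → product T ≤ product W
  T≤W {W} W∈ with feasible-starts-with-1 {n} W∈
  ... | w , W≡ , sumW≡ = begin
    product T                   ≡⟨ cong product T≡T₁ ⟩
    product T₁                  ≤⟨ atLeast-minimises-product 4≤M ≤-refl w sumT₁≤sumW ⟩
    product (elemsFrom 1 w)     ≡⟨ *-identityˡ _ ⟨
    product (1 ∷ elemsFrom 1 w) ≡⟨ cong product W≡ ⟨
    product W                   ∎
    where
    sumT₁≤sumW : sum T₁ ≤ sum (elemsFrom 1 w)
    sumT₁≤sumW = begin
      sum T₁                ≡⟨ cong sum T≡T₁ ⟨
      sum T                 ≤⟨ sumT≤k ⟩
      k                     ≡⟨ suc-injective sumW≡ ⟨
      sum (elemsFrom 1 w)   ∎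

feasible-insert-1 : ∀ {P n k B} → P 1 ≡ false → 1 ≤ n → suc (sum (members P 0 n)) ≡ k →
  product (members P 0 n) ≤ B → ∃[ V ] V ∈ feasible n k × product V ≤ B
feasible-insert-1 {P} {n} P1 1≤n sum≡k prod≤B =
    members (insert 1 P) 0 n
  , feasible⁺ (charVec (insert 1 P) 0 n) (∈-resp-↭ (↭-sym perm) (here refl)) (trans (sum-↭ perm) sum≡k)
  , subst (_≤ _) (trans (sym (*-identityˡ _)) (sym (product-↭ perm))) prod≤B
  where
  perm : members (insert 1 P) 0 n ↭ 1 ∷ members P 0 n
  perm = members-insert 0 n P1 (s≤s z≤n) 1≤n

feasible-near-atLeast : ∀ {n j} d {k} → 3 ≤ j → j < n → d < j →
  suc (sum (members (atLeast (suc j)) 0 n) + d) ≡ k →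
  ∃[ V ] V ∈ feasible n k × product V ≤ suc n * product (members (atLeast (suc j)) 0 n)
feasible-near-atLeast {n} {j} zero 3≤j j<n _ k≡ =
  feasible-insert-1 (atLeast-false (s≤s (≤-trans (s≤s z≤n) 3≤j))) 1≤n
    (trans (cong suc (sym (+-identityʳ _))) k≡) (m≤n*m _ (suc n))
  where 1≤n = ≤-trans (s≤s z≤n) j<n
feasible-near-atLeast {n} {j} 1 {k} 3≤j j<n _ k≡ = feasible-insert-1 Q1 1≤n sum≡ prod≤
  where
  open ≤-Reasoning
  1≤n = ≤-trans (s≤s z≤n) j<n
  1≢j : 1 ≢ j
  1≢j 1≡j = contradiction (subst (3 ≤_) (sym 1≡j) 3≤j) λ { (s≤s ()) }
  2≢j : 2 ≢ j
  2≢j 2≡j = contradiction (subst (3 ≤_) (sym 2≡j) 3≤j) λ { (s≤s (s≤s ())) }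
  T′ = members (atLeast (2 + j)) 0 n
  Q = insert 2 (insert j (atLeast (2 + j)))
  T↭ : members (atLeast (suc j)) 0 n ↭ suc j ∷ T′
  T↭ = members-atLeast-↭ 0 n (s≤s z≤n) j<n
  Q1 : Q 1 ≡ false
  Q1 = insert-false {insert j (atLeast (2 + j))} {2} {1} (λ ())
         (insert-false {atLeast (2 + j)} {j} {1} 1≢j (atLeast-false {2 + j} (s≤s (s≤s z≤n))))
  Q2 : insert j (atLeast (2 + j)) 2 ≡ false
  Q2 = insert-false {atLeast (2 + j)} 2≢j (atLeast-false (s≤s (s≤s (≤-trans (s≤s z≤n) 3≤j))))
  Qj : atLeast (2 + j) j ≡ false
  Qj = atLeast-false (≤-trans (n<1+n j) (n≤1+n (suc j)))
  0<j = ≤-trans (s≤s z≤n) 3≤j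
  2≤n : 2 ≤ n
  2≤n = ≤-trans (s≤s (s≤s z≤n)) (≤-trans 3≤j (<⇒≤ j<n))
  sum≡ : suc (sum (members Q 0 n)) ≡ k
  sum≡ = begin-equality
    suc (sum (members Q 0 n))             ≡⟨ cong suc (sum-members-insert Q2 (s≤s z≤n) 2≤n) ⟩
    suc (2 + sum (members (insert j (atLeast (2 + j))) 0 n))
                                          ≡⟨ cong (λ s → suc (2 + s)) (sum-members-insert Qj 0<j (<⇒≤ j<n)) ⟩
    suc (2 + (j + sum T′))                ≡⟨ rearrange j (sum T′) ⟩
    suc (suc j + sum T′ + 1)              ≡⟨ cong (λ s → suc (s + 1)) (sum-↭ T↭) ⟨
    suc (sum (members (atLeast (suc j)) 0 n) + 1) ≡⟨ k≡ ⟩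
    k                                     ∎
    where
    rearrange : ∀ j s → suc (2 + (j + s)) ≡ suc (suc j + s + 1)
    rearrange = solve-∀
  prod≤ : product (members Q 0 n) ≤ suc n * product (members (atLeast (suc j)) 0 n)
  prod≤ = begin
    product (members Q 0 n)             ≡⟨ product-members-insert Q2 (s≤s z≤n) 2≤n ⟩
    2 * product (members (insert j (atLeast (2 + j))) 0 n)
                                        ≡⟨ cong (2 *_) (product-members-insert Qj 0<j (<⇒≤ j<n)) ⟩
    2 * (j * product T′)                ≤⟨ *-mono-≤ (≤-trans 2≤n (n≤1+n n)) (*-monoˡ-≤ (product T′) (n≤1+n j)) ⟩
    suc n * (suc j * product T′)        ≡⟨ cong (suc n *_) (product-↭ T↭) ⟨
    suc n * product (members (atLeast (suc j)) 0 n)  ∎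
feasible-near-atLeast {n} {j} d@(suc (suc _)) {k} 3≤j j<n d<j k≡ =
  feasible-insert-1 (insert-false {atLeast (suc j)} {d} {1} (λ ()) (atLeast-false 1<1+j)) 1≤n sum≡ prod≤
  where
  open ≤-Reasoning
  1≤n = ≤-trans (s≤s z≤n) j<n
  1<1+j = s≤s (≤-trans (s≤s z≤n) 3≤j)
  T = members (atLeast (suc j)) 0 n
  Td : atLeast (suc j) d ≡ false
  Td = atLeast-false (≤-trans d<j (n≤1+n j))
  d≤n : d ≤ n
  d≤n = ≤-trans (<⇒≤ d<j) (<⇒≤ j<n)
  sum≡ : suc (sum (members (insert d (atLeast (suc j))) 0 n)) ≡ k
  sum≡ = trans (cong suc (trans (sum-members-insert Td (s≤s z≤n) d≤n) (+-comm d (sum T)))) k≡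
  prod≤ : product (members (insert d (atLeast (suc j))) 0 n) ≤ suc n * product T
  prod≤ = begin
    product (members (insert d (atLeast (suc j))) 0 n)  ≡⟨ product-members-insert Td (s≤s z≤n) d≤n ⟩
    d * product T                                       ≤⟨ *-monoˡ-≤ (product T) (≤-trans d≤n (n≤1+n n)) ⟩
    suc n * product T                                   ∎

-- Rational bounds

toℚᵘ-/ : ∀ a b .{{_ : NonZero b}} → toℚᵘ ((+ a) /ℚ b) ≃ (+ a) /ᵘ b
toℚᵘ-/ a (suc b) = toℚᵘ-fromℚᵘ (mkℚᵘ (+ a) b)

/ᵘ-mono-≤ : ∀ a b c d .{{_ : NonZero b}} .{{_ : NonZero d}} →
            a * d ≤ c * b → (+ a) /ᵘ b ℚᵘ.≤ (+ c) /ᵘ d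
/ᵘ-mono-≤ a (suc b) c (suc d) ad≤cb =
  *≤* (subst₂ ℤ._≤_ (ℤ.pos-* a (suc d)) (ℤ.pos-* c (suc b)) (+≤+ ad≤cb))

/-mono-≤ : ∀ a b c d .{{_ : NonZero b}} .{{_ : NonZero d}} →
           a * d ≤ c * b → (+ a) /ℚ b ≤ℚ (+ c) /ℚ d
/-mono-≤ a b c d ad≤cb = toℚᵘ-cancel-≤ (begin
  toℚᵘ ((+ a) /ℚ b)  ≃⟨ toℚᵘ-/ a b ⟩
  (+ a) /ᵘ b         ≤⟨ /ᵘ-mono-≤ a b c d ad≤cb ⟩
  (+ c) /ᵘ d         ≃⟨ toℚᵘ-/ c d ⟨
  toℚᵘ ((+ c) /ℚ d)  ∎)
  where open ℚᵘ.≤-Reasoning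

/ᵘ-*-/ᵘ1 : ∀ a b c .{{_ : NonZero b}} → (+ (a * c)) /ᵘ b ≡ ((+ a) /ᵘ b) *ᵘ ((+ c) /ᵘ 1)
/ᵘ-*-/ᵘ1 a (suc b) c = cong₂ mkℚᵘ (ℤ.pos-* a c) (sym (*-identityʳ b))

expPartial-1 : ∀ n → toℚᵘ (expPartial n 1) ≃ (+ suc n) /ᵘ 1
expPartial-1 n = ℚᵘ.≃-trans (toℚᵘ-homo-+ ((+ 1) /ℚ 1) ((+ (n ^ 1)) /ℚ 1))
  (ℚᵘ.≃-trans (ℚᵘ.+-cong (toℚᵘ-/ 1 1) (toℚᵘ-/ (n ^ 1) 1))
    (ℚᵘ.≃-reflexive (cong (λ x → mkℚᵘ (+ 1 ℤ.+ x) 0)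
                          (trans (ℤ.*-identityʳ (+ (n ^ 1))) (cong +_ (^-identityʳ n))))))

≤-/-*-expPartial-1 : ∀ c a b n .{{_ : NonZero b}} → c * b ≤ a * suc n →
                      (+ c) /ℚ 1 ≤ℚ ((+ a) /ℚ b) *ℚ expPartial n 1
≤-/-*-expPartial-1 c a b n cb≤a[1+n] = toℚᵘ-cancel-≤ (begin
  toℚᵘ ((+ c) /ℚ 1)                                ≃⟨ toℚᵘ-/ c 1 ⟩
  (+ c) /ᵘ 1                                       ≤⟨ /ᵘ-mono-≤ c 1 (a * suc n) b
                                                        (subst (c * b ≤_) (sym (*-identityʳ (a * suc n))) cb≤a[1+n]) ⟩
  (+ (a * suc n)) /ᵘ b                             ≡⟨ /ᵘ-*-/ᵘ1 a b (suc n) ⟩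
  ((+ a) /ᵘ b) *ᵘ ((+ suc n) /ᵘ 1)                 ≃⟨ ℚᵘ.*-cong (toℚᵘ-/ a b) (expPartial-1 n) ⟨
  toℚᵘ ((+ a) /ℚ b) *ᵘ toℚᵘ (expPartial n 1)       ≃⟨ toℚᵘ-homo-* ((+ a) /ℚ b) (expPartial n 1) ⟨
  toℚᵘ (((+ a) /ℚ b) *ℚ expPartial n 1)            ∎)
  where open ℚᵘ.≤-Reasoning

m-factorial-bounds : ∀ {n j k} → 3 ≤ j → j < n →
  let T = members (atLeast (suc j)) 0 n in sum T ≤ k → k < sum T + j →
  n ! * 1 ≤ m n (suc k) * j ! × m n (suc k) * j ! ≤ n ! * suc n
m-factorial-bounds {n@(suc _)} {j} {k} 3≤j j<n sumT≤k k<sumT+j = lower , upper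
  where
  open ≤-Reasoning
  T = members (atLeast (suc j)) 0 n
  d<j : k ∸ sum T < j
  d<j = m<n+o⇒m∸n<o k (sum T) {{>-nonZero (≤-trans (s≤s z≤n) 3≤j)}} k<sumT+j
  witness = feasible-near-atLeast (k ∸ sum T) 3≤j j<n d<j (cong suc (m+[n∸m]≡n sumT≤k))
  V∈ = proj₁ (proj₂ witness)
  V≤ = proj₂ (proj₂ witness)
  T!≡n! : product T * j ! ≡ n !
  T!≡n! = product-atLeast (<⇒≤ j<n)
  lower = begin
    n ! * 1              ≡⟨ *-identityʳ (n !) ⟩
    n !                  ≡⟨ T!≡n! ⟨
    product T * j !      ≤⟨ *-monoˡ-≤ (j !) (product-atLeast≤m (s≤s 3≤j) sumT≤k V∈) ⟩
    m n (suc k) * j !    ∎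
  upper = begin
    m n (suc k) * j !        ≤⟨ *-monoˡ-≤ (j !) (≤-trans (m≤product {n} {suc k} V∈) V≤) ⟩
    suc n * product T * j !  ≡⟨ x*y*z≡y*z*x (suc n) (product T) (j !) ⟩
    product T * j ! * suc n  ≡⟨ cong (_* suc n) T!≡n! ⟩
    n ! * suc n              ∎
    where
    x*y*z≡y*z*x : ∀ x y z → x * y * z ≡ y * z * x
    x*y*z≡y*z*x = solve-∀

lemma4p8 : (n k i₀ : ℕ) → 3 < n → n + 1 ≤ k → k * 2 < n * (n ∸ 1) →
    sumDown n i₀ ≤ k ∸ 1 → (∀ i → sumDown n i ≤ k ∸ 1 → i ≤ i₀) →
    (Γ-ratio (n + 1) (n ∸ i₀) ≤ℚ ((+ m n k) /ℚ 1))
    × (∃[ N ] ((+ m n k) /ℚ 1 ≤ℚ Γ-ratio (n + 1) (n ∸ i₀) *ℚ expPartial n N))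
lemma4p8 zero       _       _  () _ _ _ _
lemma4p8 (suc _)    zero    _  _  () _ _ _
lemma4p8 n@(suc n′) (suc k) i₀ 3<n _ k*2<n*n′ i₀-fits i₀-greatest =
    /-mono-≤ (Γ (n + 1)) (Γ (n ∸ i₀)) (m n (suc k)) 1 {{Γ≢0}} lower
  , 1 , ≤-/-*-expPartial-1 (m n (suc k)) (Γ (n + 1)) (Γ (n ∸ i₀)) n {{Γ≢0}} upper
  where
  4≤n∸i₀ : 4 ≤ n ∸ i₀
  4≤n∸i₀ = sumDown-fits⇒4≤n∸i {n} {suc k} {i₀} 3<n k*2<n*n′ i₀-fits
  i₀<n : i₀ < n
  i₀<n = m∸n≢0⇒n<m (λ n∸i₀≡0 → contradiction (subst (4 ≤_) n∸i₀≡0 4≤n∸i₀) λ ())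
  j = n ∸ suc i₀
  n∸i₀≡1+j : n ∸ i₀ ≡ suc j
  n∸i₀≡1+j = ∸-suc i₀<n
  sumT≡ : sum (members (atLeast (suc j)) 0 n) ≡ sumDown n i₀
  sumT≡ = subst (λ M → sum (members (atLeast M) 0 n) ≡ sumDown n i₀) n∸i₀≡1+j (sum-atLeast i₀<n)
  -- i₀ + 1 does not fit, by maximality
  k<sumT+j : k < sum (members (atLeast (suc j)) 0 n) + j
  k<sumT+j = subst (λ s → k < s + j) (sym sumT≡) (≰⇒> λ fits → n≮n i₀ (i₀-greatest (suc i₀) fits))
  bounds = m-factorial-bounds (≤-pred (subst (4 ≤_) n∸i₀≡1+j 4≤n∸i₀)) (s≤s (m∸n≤m n′ i₀))
                              (subst (_≤ k) (sym sumT≡) i₀-fits) k<sumT+j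
  Γ[n+1]≡n! : Γ (n + 1) ≡ n !
  Γ[n+1]≡n! = cong _! (m+n∸n≡m n 1)
  Γ[n∸i₀]≡j! : Γ (n ∸ i₀) ≡ j !
  Γ[n∸i₀]≡j! = cong (λ x → (x ∸ 1) !) n∸i₀≡1+j
  Γ≢0 : NonZero (Γ (n ∸ i₀))
  Γ≢0 = (n ∸ i₀ ∸ 1) !≢0
  lower : Γ (n + 1) * 1 ≤ m n (suc k) * Γ (n ∸ i₀)
  lower = subst₂ (λ a b → a * 1 ≤ m n (suc k) * b) (sym Γ[n+1]≡n!) (sym Γ[n∸i₀]≡j!) (proj₁ bounds)
  upper : m n (suc k) * Γ (n ∸ i₀) ≤ Γ (n + 1) * suc n
  upper = subst₂ (λ a b → m n (suc k) * b ≤ a * suc n) (sym Γ[n+1]≡n!) (sym Γ[n∸i₀]≡j!) (proj₂ bounds)
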